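{- Let $m\ge1$ and let $s$ be a positive integer such that $\gcd(s+m,3m)=1$. For any $\eta\in\mathbb{F}_{2^{3m}}$ with $\eta\neq1$ there exist a unique $x_0\in\mathbb{F}_{2^{3m}}^*$ and a unique $y_0\in\mathbb{F}_{2^{3m}}^*$ such that \[(x_0^{2^s},\,x_0+x_0^{2^{s+m}})=(y_0,\,\eta y_0^{2^m}).\] -}

module Defs where

open import Level using (Level; _⊔_)
open import Data.Nat using (ℕ)
open import Data.Fin using (Fin)
open import Data.Product using (Σ; ∃; _×_)
open import Relation.Nullary using (¬_)
open import Relation.Binary.PropositionalEquality using (setoid)
open import Function.Bundles using (Bijection)
open import Algebra.Bundles using (CommutativeRing; Semiring)
import Algebra.Definitions.RawSemiring as RSDefs

record IsFieldCR {c ℓ : Level} (R : CommutativeRing c ℓ) : Set (c ⊔ ℓ) where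
  open CommutativeRing R
  field
    0≉1     : ¬ (0# ≈ 1#)
    inverse : ∀ x → ¬ (x ≈ 0#) → Σ Carrier (λ y → x * y ≈ 1#)

record IsFiniteFieldOfOrder {c ℓ : Level} (R : CommutativeRing c ℓ) (q : ℕ) : Set (c ⊔ ℓ) where
  field
    isField     : IsFieldCR R
    cardinality : Bijection (CommutativeRing.setoid R) (setoid (Fin q))

module Pow {c ℓ : Level} (R : CommutativeRing c ℓ) where
  open RSDefs (Semiring.rawSemiring (CommutativeRing.semiring R)) public using (_^_)

module Submission where

open import Defs
open import Level using (Level)
open import Data.Nat using (ℕ; zero; suc; s≤s; _≤_)
import Data.Nat as N
import Data.Nat.Properties as NP
open import Data.Nat.GCD using (gcd; GCD; gcd-GCD; module Bézout)
open import Data.Nat.Tactic.RingSolver using (solve)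
open import Data.Fin using (Fin; punchIn) renaming (_≟_ to _≟ᶠ_)
open import Data.Fin.Properties using (punchInᵢ≢i)
open import Data.Fin.Permutation as Perm using (Permutation; _⟨$⟩ʳ_)
open import Data.List using (_∷_; [])
open import Data.Vec.Functional using (removeAt)
open import Data.Product using (Σ; _×_; _,_; proj₁; proj₂)
open import Data.Empty using (⊥-elim)
open import Relation.Nullary using (¬_; yes; no)
open import Relation.Binary.PropositionalEquality using (_≡_)
import Relation.Binary.PropositionalEquality as ≡
open import Function.Bundles using (Bijection)
open import Algebra.Bundles using (CommutativeRing)
import Algebra.Definitions as AlgebraDefinitions
import Algebra.Properties.CommutativeSemiring.Exp as ExpProperties
import Algebra.Properties.CommutativeMonoid.Sum as SumProperties
import Algebra.Properties.Group as GroupProperties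
import Relation.Binary.Reasoning.Setoid as SetoidReasoning

-- Write Q = 2 ^ (s + m) and q = 2 ^ (3 m). Substituting y = x ^ (2 ^ s), the system becomes
-- x + x ^ Q = η x ^ Q, i.e. x ^ Q = d x with d = (η - 1)⁻¹. As gcd (s + m) (3 m) = 1 there are
-- I, J with I (s + m) = 1 + 3 m J, so Q ^ I = 2 q ^ J; since z ^ q = z on the field, applying
-- z ↦ z ^ Q I times is squaring. A nonzero solution then satisfies x ^ (Q ^ I) = D x for an
-- explicit D depending only on d, i.e. x² = D x, so x = D; conversely D is a solution.

module _ where
  open N using (_+_; _*_; _^_)
  open ≡ using (cong; subst; sym; trans)
  open ≡.≡-Reasoning

  -- The negative Bézout identity 1 + i a = j b is turned positive by multiplying it by b - 1.
  gcd≡1⇒Bézout⁺ : ∀ a b → 2 ≤ b → gcd a b ≡ 1 → Σ ℕ λ i → Σ ℕ λ j → i * a ≡ 1 + j * b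
  gcd≡1⇒Bézout⁺ a (suc zero) (s≤s ()) _
  gcd≡1⇒Bézout⁺ a b@(suc (suc b′)) _ gcd≡1
    with Bézout.identity (subst (GCD a b) gcd≡1 (gcd-GCD a b))
  ... | Bézout.+- i j eq = i , j , sym eq
  ... | Bézout.-+ i (suc j) eq = suc b′ * i , b′ + suc b′ * j ,
    NP.+-cancelˡ-≡ (suc b′) _ _ (begin
      suc b′ + suc b′ * i * a              ≡⟨ solve (b′ ∷ i ∷ a ∷ []) ⟩
      suc b′ * (1 + i * a)                 ≡⟨ cong (suc b′ *_) eq ⟩
      suc b′ * (suc j * b)                 ≡⟨ solve (b′ ∷ j ∷ []) ⟩
      suc b′ + (1 + (b′ + suc b′ * j) * b) ∎)

  2^-Bézout : ∀ {a b i j} → i * a ≡ 1 + j * b → (2 ^ a) ^ i ≡ 2 * (2 ^ b) ^ j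
  2^-Bézout {a} {b} {i} {j} eq = begin
    (2 ^ a) ^ i     ≡⟨ NP.^-*-assoc 2 a i ⟩
    2 ^ (a * i)     ≡⟨ cong (2 ^_) (trans (NP.*-comm a i) eq) ⟩
    2 * 2 ^ (j * b) ≡⟨ cong (λ e → 2 * 2 ^ e) (NP.*-comm j b) ⟩
    2 * 2 ^ (b * j) ≡⟨ cong (2 *_) (NP.^-*-assoc 2 b j) ⟨
    2 * (2 ^ b) ^ j ∎

module FieldProperties {c ℓ : Level} (F : CommutativeRing c ℓ) (isField : IsFieldCR F) where
  open CommutativeRing F
  open IsFieldCR isField
  open ExpProperties commutativeSemiring
  open AlgebraDefinitions _≈_ using (AlmostLeftCancellative)
  open GroupProperties +-group using () renaming (∙-cancelʳ to +-cancelʳ)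
  open SumProperties *-commutativeMonoid using ()
    renaming (sum to product; sum-remove to product-remove; sum-permute to product-permute;
              sum-cong-≋ to product-cong; ∑-distrib-+ to product-distrib-*;
              sum-replicate to product-replicate)
  open SetoidReasoning setoid

  1≉0 : ¬ 1# ≈ 0#
  1≉0 1≈0 = 0≉1 (sym 1≈0)

  _⁻¹⟨_⟩ : ∀ x → ¬ x ≈ 0# → Carrier
  x ⁻¹⟨ x≉0 ⟩ = proj₁ (inverse x x≉0)

  *-inverseʳ : ∀ x (x≉0 : ¬ x ≈ 0#) → x * x ⁻¹⟨ x≉0 ⟩ ≈ 1#
  *-inverseʳ x x≉0 = proj₂ (inverse x x≉0)

  *-inverseˡ : ∀ x (x≉0 : ¬ x ≈ 0#) → x ⁻¹⟨ x≉0 ⟩ * x ≈ 1#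
  *-inverseˡ x x≉0 = trans (*-comm _ x) (*-inverseʳ x x≉0)

  *-cancelˡ-nonZero : AlmostLeftCancellative 0# _*_
  *-cancelˡ-nonZero x y z x≉0 xy≈xz = begin
    y                  ≈⟨ *-identityˡ y ⟨
    1# * y             ≈⟨ *-congʳ (*-inverseˡ x x≉0) ⟨
    x⁻¹ * x * y        ≈⟨ *-assoc x⁻¹ x y ⟩
    x⁻¹ * (x * y)      ≈⟨ *-congˡ xy≈xz ⟩
    x⁻¹ * (x * z)      ≈⟨ *-assoc x⁻¹ x z ⟨
    x⁻¹ * x * z        ≈⟨ *-congʳ (*-inverseˡ x x≉0) ⟩
    1# * z             ≈⟨ *-identityˡ z ⟩
    z                  ∎
    where
    x⁻¹ : Carrier
    x⁻¹ = x ⁻¹⟨ x≉0 ⟩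

  *-nonZero : ∀ {x y} → ¬ x ≈ 0# → ¬ y ≈ 0# → ¬ x * y ≈ 0#
  *-nonZero {x} {y} x≉0 y≉0 xy≈0 = y≉0 (*-cancelˡ-nonZero x y 0# x≉0 (trans xy≈0 (sym (zeroʳ x))))

  ^-nonZero : ∀ {x} n → ¬ x ≈ 0# → ¬ x ^ n ≈ 0#
  ^-nonZero zero    x≉0 = 1≉0
  ^-nonZero (suc n) x≉0 = *-nonZero x≉0 (^-nonZero n x≉0)

  1^n≈1 : ∀ n → 1# ^ n ≈ 1#
  1^n≈1 zero    = refl
  1^n≈1 (suc n) = trans (*-identityˡ _) (1^n≈1 n)

  product-nonZero : ∀ {n} (f : Fin n → Carrier) → (∀ i → ¬ f i ≈ 0#) → ¬ product f ≈ 0#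
  product-nonZero {zero}  f f≉0 = 1≉0
  product-nonZero {suc n} f f≉0 =
    *-nonZero (f≉0 Fin.zero) (product-nonZero (λ i → f (Fin.suc i)) (λ i → f≉0 (Fin.suc i)))

  product-scale : ∀ {n} x (f : Fin n → Carrier) → product (λ i → x * f i) ≈ x ^ n * product f
  product-scale {n} x f = trans (product-distrib-* (λ _ → x) f) (*-congʳ (product-replicate n))

  module FiniteField {n : ℕ} (card : Bijection setoid (≡.setoid (Fin (suc n)))) where
    open Bijection card using (injective; surjective) renaming (to to index; cong to index-cong)

    element : Fin (suc n) → Carrier
    element i = proj₁ (surjective i)

    index-element : ∀ i → index (element i) ≡ i
    index-element i = proj₂ (surjective i) refl

    element-index : ∀ x → element (index x) ≈ x
    element-index x = injective (index-element (index x))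

    i₀ : Fin (suc n)
    i₀ = index 0#

    element-nonZero : ∀ {i} → ¬ i ≡ i₀ → ¬ element i ≈ 0#
    element-nonZero {i} i≢i₀ e≈0 = i≢i₀ (≡.trans (≡.sym (index-element i)) (index-cong e≈0))

    unit : Fin (suc n) → Carrier
    unit i with i ≟ᶠ i₀
    ... | yes _ = 1#
    ... | no  _ = element i

    unit-i₀ : unit i₀ ≈ 1#
    unit-i₀ with i₀ ≟ᶠ i₀
    ... | yes _     = refl
    ... | no  i₀≢i₀ = ⊥-elim (i₀≢i₀ ≡.refl)

    unit-≢i₀ : ∀ {i} → ¬ i ≡ i₀ → unit i ≈ element i
    unit-≢i₀ {i} i≢i₀ with i ≟ᶠ i₀
    ... | yes i≡i₀ = ⊥-elim (i≢i₀ i≡i₀)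
    ... | no  _    = refl

    unit-punchIn : ∀ j → ¬ unit (punchIn i₀ j) ≈ 0#
    unit-punchIn j u≈0 = element-nonZero i≢i₀ (trans (sym (unit-≢i₀ i≢i₀)) u≈0)
      where
      i≢i₀ : ¬ punchIn i₀ j ≡ i₀
      i≢i₀ = punchInᵢ≢i i₀ j

    scaling : ∀ x → ¬ x ≈ 0# → Permutation (suc n) (suc n)
    scaling x x≉0 = Perm.permutation (λ i → index (x * element i)) (λ i → index (x⁻¹ * element i))
      (λ i → ≡.trans (index-cong (cancel x x⁻¹ (*-inverseʳ x x≉0) i)) (index-element i))
      (λ i → ≡.trans (index-cong (cancel x⁻¹ x (*-inverseˡ x x≉0) i)) (index-element i))
      where
      x⁻¹ : Carrier
      x⁻¹ = x ⁻¹⟨ x≉0 ⟩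
      cancel : ∀ a b → a * b ≈ 1# → ∀ i → a * element (index (b * element i)) ≈ element i
      cancel a b ab≈1 i = begin
        a * element (index (b * element i)) ≈⟨ *-congˡ (element-index _) ⟩
        a * (b * element i)                 ≈⟨ *-assoc a b _ ⟨
        a * b * element i                   ≈⟨ *-congʳ ab≈1 ⟩
        1# * element i                      ≈⟨ *-identityˡ _ ⟩
        element i                           ∎

    scaling-i₀ : ∀ x x≉0 → scaling x x≉0 ⟨$⟩ʳ i₀ ≡ i₀
    scaling-i₀ x _ = index-cong (trans (*-congˡ (element-index 0#)) (zeroʳ x))

    unit-scaling : ∀ x x≉0 j → unit (scaling x x≉0 ⟨$⟩ʳ punchIn i₀ j) ≈ x * unit (punchIn i₀ j)
    unit-scaling x x≉0 j = begin
      unit (index (x * element i))    ≈⟨ unit-≢i₀ xi≢i₀ ⟩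
      element (index (x * element i)) ≈⟨ element-index _ ⟩
      x * element i                   ≈⟨ *-congˡ (unit-≢i₀ i≢i₀) ⟨
      x * unit i                      ∎
      where
      i : Fin (suc n)
      i = punchIn i₀ j
      i≢i₀ : ¬ i ≡ i₀
      i≢i₀ = punchInᵢ≢i i₀ j
      xi≢i₀ : ¬ index (x * element i) ≡ i₀
      xi≢i₀ xi≡i₀ = *-nonZero x≉0 (element-nonZero i≢i₀) (injective xi≡i₀)

    -- Multiplication by x permutes the units, so their product P satisfies P ≈ x ^ n * P.
    ^-card-1 : ∀ x → ¬ x ≈ 0# → x ^ n ≈ 1#
    ^-card-1 x x≉0 = sym (*-cancelˡ-nonZero P 1# (x ^ n) P≉0 (begin
      P * 1#                                       ≈⟨ *-comm P 1# ⟩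
      1# * P                                       ≈⟨ *-congʳ unit-i₀ ⟨
      unit i₀ * P                                  ≈⟨ product-remove {i = i₀} unit ⟨
      product unit                                 ≈⟨ product-permute unit π ⟩
      product (λ i → unit (π ⟨$⟩ʳ i))              ≈⟨ product-remove {i = i₀} (λ i → unit (π ⟨$⟩ʳ i)) ⟩
      unit (π ⟨$⟩ʳ i₀) * product (removeAt (λ i → unit (π ⟨$⟩ʳ i)) i₀)
        ≈⟨ *-cong (trans (reflexive (≡.cong unit (scaling-i₀ x x≉0))) unit-i₀)
                  (product-cong (unit-scaling x x≉0)) ⟩
      1# * product (λ j → x * unit (punchIn i₀ j)) ≈⟨ *-identityˡ _ ⟩
      product (λ j → x * unit (punchIn i₀ j))      ≈⟨ product-scale x (removeAt unit i₀) ⟩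
      x ^ n * P                                    ≈⟨ *-comm _ P ⟩
      P * x ^ n                                    ∎))
      where
      π : Permutation (suc n) (suc n)
      π = scaling x x≉0
      P : Carrier
      P = product (removeAt unit i₀)
      P≉0 : ¬ P ≈ 0#
      P≉0 = product-nonZero (removeAt unit i₀) unit-punchIn

    ^-card : ∀ x → x ^ suc n ≈ x
    ^-card x with index x ≟ᶠ i₀
    ... | yes x≡i₀ = trans (*-congʳ x≈0) (trans (zeroˡ _) (sym x≈0))
      where
      x≈0 : x ≈ 0#
      x≈0 = injective x≡i₀
    ... | no  x≢i₀ = trans (*-congˡ (^-card-1 x (λ x≈0 → x≢i₀ (index-cong x≈0)))) (*-identityʳ x)

  ^-card : ∀ q → Bijection setoid (≡.setoid (Fin q)) → ∀ x → x ^ q ≈ x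
  ^-card zero    card x with Bijection.to card x
  ... | ()
  ^-card (suc n) card = FiniteField.^-card card

  ^-^-fixed : ∀ q → (∀ x → x ^ q ≈ x) → ∀ x j → x ^ (q N.^ j) ≈ x
  ^-^-fixed q x^q≈x x zero    = *-identityʳ x
  ^-^-fixed q x^q≈x x (suc j) = begin
    x ^ (q N.* q N.^ j) ≈⟨ ^-assocʳ x q (q N.^ j) ⟨
    (x ^ q) ^ (q N.^ j) ≈⟨ ^-congˡ (q N.^ j) (x^q≈x x) ⟩
    x ^ (q N.^ j)       ≈⟨ ^-^-fixed q x^q≈x x j ⟩
    x                   ∎

  ^-2*q^≈square : ∀ q → (∀ x → x ^ q ≈ x) → ∀ x j → x ^ (2 N.* q N.^ j) ≈ x * x
  ^-2*q^≈square q x^q≈x x j = begin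
    x ^ (2 N.* q N.^ j)   ≈⟨ ^-assocʳ x 2 (q N.^ j) ⟨
    (x ^ 2) ^ (q N.^ j)   ≈⟨ ^-^-fixed q x^q≈x (x ^ 2) j ⟩
    x * (x * 1#)          ≈⟨ *-congˡ (*-identityʳ x) ⟩
    x * x                 ∎

  ^-2^-^-2^ : ∀ x a b → (x ^ (2 N.^ a)) ^ (2 N.^ b) ≈ x ^ (2 N.^ (a N.+ b))
  ^-2^-^-2^ x a b = trans (^-assocʳ x (2 N.^ a) (2 N.^ b)) (^-congʳ x (≡.sym (NP.^-distribˡ-+-* 2 a b)))

  module Root (Q I : ℕ) (squaring : ∀ x → x ^ (Q N.^ I) ≈ x * x) (d : Carrier) (d≉0 : ¬ d ≈ 0#) where

    -- D k = d ^ (1 + Q + ⋯ + Q ^ (k - 1)), so that x ^ (Q ^ k) ≈ D k * x whenever x ^ Q ≈ d * x.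
    D : ℕ → Carrier
    D zero    = 1#
    D (suc k) = d * D k ^ Q

    D-nonZero : ∀ k → ¬ D k ≈ 0#
    D-nonZero zero    = 1≉0
    D-nonZero (suc k) = *-nonZero d≉0 (^-nonZero Q (D-nonZero k))

    D-suc : ∀ k → D (suc k) ≈ D k * d ^ (Q N.^ k)
    D-suc zero    = trans (*-congˡ (1^n≈1 Q)) (sym (*-identityˡ _))
    D-suc (suc k) = begin
      d * D (suc k) ^ Q                      ≈⟨ *-congˡ (^-congˡ Q (D-suc k)) ⟩
      d * (D k * d ^ (Q N.^ k)) ^ Q          ≈⟨ *-congˡ (^-distrib-* _ _ Q) ⟩
      d * (D k ^ Q * (d ^ (Q N.^ k)) ^ Q)    ≈⟨ *-assoc _ _ _ ⟨
      D (suc k) * (d ^ (Q N.^ k)) ^ Q        ≈⟨ *-congˡ (^-assocʳ d (Q N.^ k) Q) ⟩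
      D (suc k) * d ^ (Q N.^ k N.* Q)        ≈⟨ *-congˡ (^-congʳ d (NP.*-comm (Q N.^ k) Q)) ⟩
      D (suc k) * d ^ (Q N.^ suc k)          ∎

    ^-Q^ : ∀ {x} → x ^ Q ≈ d * x → ∀ k → x ^ (Q N.^ k) ≈ D k * x
    ^-Q^ {x} x^Q≈dx zero    = trans (*-identityʳ x) (sym (*-identityˡ x))
    ^-Q^ {x} x^Q≈dx (suc k) = begin
      x ^ (Q N.* Q N.^ k)   ≈⟨ ^-congʳ x (NP.*-comm Q (Q N.^ k)) ⟩
      x ^ (Q N.^ k N.* Q)   ≈⟨ ^-assocʳ x (Q N.^ k) Q ⟨
      (x ^ (Q N.^ k)) ^ Q   ≈⟨ ^-congˡ Q (^-Q^ x^Q≈dx k) ⟩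
      (D k * x) ^ Q         ≈⟨ ^-distrib-* (D k) x Q ⟩
      D k ^ Q * x ^ Q       ≈⟨ *-congˡ x^Q≈dx ⟩
      D k ^ Q * (d * x)     ≈⟨ *-assoc _ d x ⟨
      D k ^ Q * d * x       ≈⟨ *-congʳ (*-comm _ d) ⟩
      D (suc k) * x         ∎

    root : Carrier
    root = D I

    root-nonZero : ¬ root ≈ 0#
    root-nonZero = D-nonZero I

    root-^-Q : root ^ Q ≈ d * root
    root-^-Q = *-cancelˡ-nonZero d _ _ d≉0 (begin
      d * root ^ Q            ≈⟨ D-suc I ⟩
      root * d ^ (Q N.^ I)    ≈⟨ *-congˡ (squaring d) ⟩
      root * (d * d)          ≈⟨ *-comm root _ ⟩
      d * d * root            ≈⟨ *-assoc d d root ⟩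
      d * (d * root)          ∎)

    root-unique : ∀ x → ¬ x ≈ 0# → x ^ Q ≈ d * x → x ≈ root
    root-unique x x≉0 x^Q≈dx = *-cancelˡ-nonZero x x root x≉0 (begin
      x * x                 ≈⟨ squaring x ⟨
      x ^ (Q N.^ I)         ≈⟨ ^-Q^ x^Q≈dx I ⟩
      root * x              ≈⟨ *-comm root x ⟩
      x * root              ∎)

  module Affine (η : Carrier) (η≉1 : ¬ η ≈ 1#) where

    e : Carrier
    e = η + - 1#

    η≈e+1 : η ≈ e + 1#
    η≈e+1 = sym (trans (+-assoc η (- 1#) 1#) (trans (+-congˡ (-‿inverseˡ 1#)) (+-identityʳ η)))

    e≉0 : ¬ e ≈ 0#
    e≉0 e≈0 = η≉1 (trans η≈e+1 (trans (+-congʳ e≈0) (+-identityˡ 1#)))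

    d : Carrier
    d = e ⁻¹⟨ e≉0 ⟩

    d≉0 : ¬ d ≈ 0#
    d≉0 d≈0 = 1≉0 (trans (sym (*-inverseʳ e e≉0)) (trans (*-congˡ d≈0) (zeroʳ e)))

    η*≈e*+ : ∀ X → η * X ≈ e * X + X
    η*≈e*+ X = trans (*-congʳ η≈e+1) (trans (distribʳ X e 1#) (+-congˡ (*-identityˡ X)))

    +≈η*⇒≈d* : ∀ {x X} → x + X ≈ η * X → X ≈ d * x
    +≈η*⇒≈d* {x} {X} x+X≈ηX = begin
      X             ≈⟨ *-identityˡ X ⟨
      1# * X        ≈⟨ *-congʳ (*-inverseˡ e e≉0) ⟨
      d * e * X     ≈⟨ *-assoc d e X ⟩
      d * (e * X)   ≈⟨ *-congˡ (+-cancelʳ X (e * X) x (trans (sym (η*≈e*+ X)) (sym x+X≈ηX))) ⟩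
      d * x         ∎

    ≈d*⇒+≈η* : ∀ {x X} → X ≈ d * x → x + X ≈ η * X
    ≈d*⇒+≈η* {x} {X} X≈dx = begin
      x + X             ≈⟨ +-congʳ e*X≈x ⟨
      e * X + X         ≈⟨ η*≈e*+ X ⟨
      η * X             ∎
      where
      e*X≈x : e * X ≈ x
      e*X≈x = begin
        e * X         ≈⟨ *-congˡ X≈dx ⟩
        e * (d * x)   ≈⟨ *-assoc e d x ⟨
        e * d * x     ≈⟨ *-congʳ (*-inverseʳ e e≉0) ⟩
        1# * x        ≈⟨ *-identityˡ x ⟩
        x             ∎

proposition3p1 : ∀ {c ℓ : Level} (m s : ℕ) → 1 ≤ m → 1 ≤ s → gcd (s N.+ m) (3 N.* m) ≡ 1 →
    (F : CommutativeRing c ℓ) → IsFiniteFieldOfOrder F (2 N.^ (3 N.* m)) →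
    let open CommutativeRing F
        open Pow F
    in (η : Carrier) → ¬ (η ≈ 1#) →
    Σ Carrier (λ x₀ → Σ Carrier (λ y₀ →
      (¬ (x₀ ≈ 0#) × ¬ (y₀ ≈ 0#)
        × (x₀ ^ (2 N.^ s) ≈ y₀)
        × (x₀ + x₀ ^ (2 N.^ (s N.+ m)) ≈ η * y₀ ^ (2 N.^ m)))
      × (∀ x y → ¬ (x ≈ 0#) → ¬ (y ≈ 0#)
          → x ^ (2 N.^ s) ≈ y
          → x + x ^ (2 N.^ (s N.+ m)) ≈ η * y ^ (2 N.^ m)
          → (x ≈ x₀) × (y ≈ y₀))))
proposition3p1 m s 1≤m _ gcd≡1 F 𝔽 η η≉1 =
  root , root ^ (2 N.^ s) ,
  (root-nonZero , ^-nonZero (2 N.^ s) root-nonZero , refl ,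
    trans (≈d*⇒+≈η* root-^-Q) (*-congˡ (sym (^-2^-^-2^ root s m)))) ,
  λ x y x≉0 _ x^2^s≈y x+x^Q≈ηy^2^m →
    let x≈root = root-unique x x≉0 (+≈η*⇒≈d* (trans x+x^Q≈ηy^2^m
                   (*-congˡ (trans (^-congˡ (2 N.^ m) (sym x^2^s≈y)) (^-2^-^-2^ x s m)))))
    in x≈root , trans (sym x^2^s≈y) (^-congˡ (2 N.^ s) x≈root)
  where
  open CommutativeRing F
  open IsFiniteFieldOfOrder 𝔽
  open FieldProperties F isField
  open ExpProperties commutativeSemiring

  Bézout⁺ : Σ ℕ λ i → Σ ℕ λ j → i N.* (s N.+ m) ≡ 1 N.+ j N.* (3 N.* m)
  Bézout⁺ = gcd≡1⇒Bézout⁺ (s N.+ m) (3 N.* m) (NP.≤-trans (NP.n≤1+n 2) (NP.*-monoʳ-≤ 3 1≤m)) gcd≡1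

  I J : ℕ
  I = proj₁ Bézout⁺
  J = proj₁ (proj₂ Bézout⁺)

  squaring : ∀ x → x ^ ((2 N.^ (s N.+ m)) N.^ I) ≈ x * x
  squaring x = trans (^-congʳ x (2^-Bézout {s N.+ m} {3 N.* m} {I} {J} (proj₂ (proj₂ Bézout⁺))))
                     (^-2*q^≈square (2 N.^ (3 N.* m)) (^-card _ cardinality) x J)

  open Affine η η≉1
  open Root (2 N.^ (s N.+ m)) I squaring d d≉0
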